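{- There is an absolute constant $c>0$ such that for every $n\ge 2$ there exists a binary matrix $M \in \{0,1\}^{n\times n}$ of twin-width at most $3$ whose row-Hamming-coherence and column-Hamming-coherence satisfy $\mathscr{H}^r(M), \mathscr{H}^c(M) \ge c\, n \log n$, i.e. $\mathscr{H}^r(M), \mathscr{H}^c(M) \in \Omega(n\log n)$.
   Context: The Hamming distance of $u,v\in\{0,1\}^n$ is $d(u,v)=\sum_{i=1}^n |u_i-v_i|$. Let $r^{(1)},\dots,r^{(n)}$ be the rows of $M$. For a permutation $\pi$ of $\{1,\dots,n\}$, the row-Hamming-sum is $\mathscr{H}^r_\pi(M)=\sum_{i=1}^{n-1} d(r^{(\pi(i))}, r^{(\pi(i+1))})$, and the row-Hamming-coherence is $\mathscr{H}^r(M)=\min_\pi \mathscr{H}^r_\pi(M)$; the column-Hamming-coherence $\mathscr{H}^c(M)$ is defined analogously using columns. A merge sequence for a binary matrix is a sequence of merges of two neighboring rows or two neighboring columns of the current matrix until a single entry remains; merging two columns gives a column whose $i$-th entry is $0$ (resp. $1$) if both merged entries are $0$ (resp. $1$), and the error symbol $\bot$ otherwise (including when one is $\bot$); row merges are analogous. $M$ is $d$-twin-ordered if it has a merge sequence in which every row and column of every intermediate matrix contains at most $d$ symbols $\bot$. The twin-width of $M$ is the least $d$ such that some reordering of its rows and of its columns is $d$-twin-ordered. -}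

module Defs where

open import Data.Nat using (ℕ; zero; suc; _+_; _*_; _≤_)
open import Data.Bool using (Bool; true; false)
open import Data.Maybe using (Maybe; just; nothing)
open import Data.Fin using (Fin; zero; suc; inject₁)
open import Data.Fin.Permutation using (Permutation′; _⟨$⟩ʳ_)
open import Data.Product using (Σ; _×_)
open import Function using (_∘_)

BinMat : ℕ → ℕ → Set
BinMat r c = Fin r → Fin c → Bool

transpose : ∀ {r c} → BinMat r c → BinMat c r
transpose M j i = M i j

diffBit : Bool → Bool → ℕ
diffBit true  true  = 0
diffBit false false = 0
diffBit true  false = 1
diffBit false true  = 1

hamming : ∀ {m} → (Fin m → Bool) → (Fin m → Bool) → ℕ
hamming {zero}  u v = 0
hamming {suc m} u v = diffBit (u zero) (v zero) + hamming (u ∘ suc) (v ∘ suc)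

sumFin : ∀ {m} → (Fin m → ℕ) → ℕ
sumFin {zero}  f = 0
sumFin {suc m} f = f zero + sumFin (f ∘ suc)

rowHammingSum : ∀ {n c} → Permutation′ n → BinMat n c → ℕ
rowHammingSum {zero} π M = 0
rowHammingSum {suc n} π M =
  sumFin {n} (λ i → hamming (M (π ⟨$⟩ʳ inject₁ i)) (M (π ⟨$⟩ʳ suc i)))

-- Row-Hamming-coherence H^r(M) = min_π H^r_π(M).  For a rational bound
-- x = a / q (q > 0), "H^r(M) ≥ a / q" unfolds to: every permutation π
-- has a ≤ q * H^r_π(M)  (the min over the finite nonempty set of
-- permutations is ≥ x iff every element is).
RowCoherenceAtLeast : ∀ {n c} → (a q : ℕ) → BinMat n c → Set
RowCoherenceAtLeast a q M = ∀ π → a ≤ q * rowHammingSum π M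

ColCoherenceAtLeast : ∀ {r n} → (a q : ℕ) → BinMat r n → Set
ColCoherenceAtLeast a q M = RowCoherenceAtLeast a q (transpose M)

-- Matrices with error symbol ⊥ (represented by nothing) and merges

Sym : Set
Sym = Maybe Bool

_⊓_ : Sym → Sym → Sym
just true  ⊓ just true  = just true
just false ⊓ just false = just false
just true  ⊓ just false = nothing
just false ⊓ just true  = nothing
nothing    ⊓ _          = nothing
just _     ⊓ nothing    = nothing

SMat : ℕ → ℕ → Set
SMat r c = Fin r → Fin c → Sym

-- squash f i : merge positions i and i+1 of a sequence of length 2+r
squash : ∀ {X : Set} {r} → (X → X → X) → (Fin (suc (suc r)) → X) → Fin (suc r) → Fin (suc r) → X
squash _∙_ f zero    zero    = f zero ∙ f (suc zero)
squash _∙_ f zero    (suc j) = f (suc (suc j))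
squash {r = suc r} _∙_ f (suc i) zero    = f zero
squash {r = suc r} _∙_ f (suc i) (suc j) = squash _∙_ (f ∘ suc) i j

mergeRows : ∀ {r c} → SMat (suc (suc r)) c → Fin (suc r) → SMat (suc r) c
mergeRows A i = squash (λ u v k → u k ⊓ v k) A i

mergeCols : ∀ {r c} → SMat r (suc (suc c)) → Fin (suc c) → SMat r (suc c)
mergeCols A i k = squash _⊓_ (A k) i

errs : ∀ {m} → (Fin m → Sym) → ℕ
errs {zero}  f = 0
errs {suc m} f with f zero
... | nothing = suc (errs (f ∘ suc))
... | just _  = errs (f ∘ suc)

Bounded : ∀ {r c} → ℕ → SMat r c → Set
Bounded d A = (∀ i → errs (A i) ≤ d) × (∀ j → errs (λ i → A i j) ≤ d)

data MergeSeq (d : ℕ) : (r c : ℕ) → SMat r c → Set where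
  done : (A : SMat 1 1) → Bounded d A → MergeSeq d 1 1 A
  rowMerge : ∀ {r c} (A : SMat (suc (suc r)) c) (i : Fin (suc r)) →
             Bounded d A → MergeSeq d (suc r) c (mergeRows A i) →
             MergeSeq d (suc (suc r)) c A
  colMerge : ∀ {r c} (A : SMat r (suc (suc c))) (i : Fin (suc c)) →
             Bounded d A → MergeSeq d r (suc c) (mergeCols A i) →
             MergeSeq d r (suc (suc c)) A

toSym : ∀ {r c} → BinMat r c → SMat r c
toSym M i j = just (M i j)

TwinOrdered : ∀ {r c} → ℕ → BinMat r c → Set
TwinOrdered {r} {c} d M = MergeSeq d r c (toSym M)

-- twin-width(M) ≤ d : some reordering of rows and columns is d-twin-ordered
-- (d-twin-ordered implies d'-twin-ordered for d ≤ d', so this is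
-- exactly "the least such d is ≤ d").
TwinWidthAtMost : ∀ {r c} → ℕ → BinMat r c → Set
TwinWidthAtMost {r} {c} d M =
  Σ (Permutation′ r) λ σ → Σ (Permutation′ c) λ τ →
    TwinOrdered d (λ i j → M (σ ⟨$⟩ʳ i) (τ ⟨$⟩ʳ j))

module Submission where

-- Off the diagonal, M x y is the parity of the split level of x and y: the highest bit in which they differ.
--
-- Coherence: if rows x and x' split at level G, then on each of the 2 ^ (G - 1) columns y of the sibling of the
-- level-(G - 1) block of x, x splits from y at level G - 1 and x' at level G, so d(x, x') ≥ 2 ^ (G - 1).  But x and
-- x' lie in different level-j blocks only for j ≤ G, so charging an adjacent pair 2 ^ j per level-j block containing
-- exactly one of them costs at most 8 d(x, x').  Along any ordering of the rows the indicator of each of the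
-- ⌊ n / 2 ^ j ⌋ full level-j blocks changes at least once, so the total charge is at least
-- Σ_{j < log n} 2 ^ j ⌊ n / 2 ^ j ⌋ ≥ n log n / 2.
--
-- Twin-width: merge sibling rows 2p, 2p + 1 and sibling columns 2p, 2p + 1 pair by pair.  Against any line outside
-- its sibling pair the two siblings carry the same entries, so a line only gets ⊥ against the at most three lines
-- sharing its sibling pair, and once all pairs are merged the matrix is the same construction one level up.

open import Defs
open import Data.Bool using (Bool; true; false; not)
open import Data.Bool.Properties using (not-¬) renaming (_≟_ to _≟ᴮ_)
open import Data.Empty using (⊥-elim)
open import Data.Fin using (Fin; zero; suc; toℕ; inject₁; fromℕ<)
open import Data.Fin.Permutation using (Permutation′; _⟨$⟩ʳ_; _⟨$⟩ˡ_; inverseʳ; id)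
open import Data.Fin.Properties using (toℕ<n; toℕ-fromℕ<; toℕ-inject₁; toℕ-injective)
open import Data.List using (List; []; _∷_; length)
open import Data.List.Membership.Propositional using (_∉_)
open import Data.List.Relation.Unary.Any using (here; there)
open import Data.Maybe using (just; nothing)
open import Data.Nat hiding (_⊓_)
open import Data.Nat.Logarithm using (⌊log₂_⌋; ⌊log₂⌊n/2⌋⌋≡⌊log₂n⌋∸1; ⌊log₂⌋-mono-≤)
open import Data.Nat.Properties
open import Algebra.Properties.CommutativeSemigroup +-commutativeSemigroup using (interchange)
open import Data.Nat.Tactic.RingSolver using (solve-∀)
open import Data.Product using (Σ; _×_; _,_)
open import Data.Sum using (_⊎_; inj₁; inj₂)
open import Function using (_∘_)
open import Relation.Binary.Definitions using (tri<; tri≈; tri>)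
open import Relation.Binary.PropositionalEquality
open import Relation.Nullary using (Dec; yes; no; does)
open import Relation.Nullary.Decidable using (dec-true; dec-false)

-- Finite sums

sumBelow : ℕ → (ℕ → ℕ) → ℕ
sumBelow zero    f = 0
sumBelow (suc k) f = f 0 + sumBelow k (f ∘ suc)

sumBelow-cong : ∀ k {f g : ℕ → ℕ} → (∀ i → i < k → f i ≡ g i) → sumBelow k f ≡ sumBelow k g
sumBelow-cong zero    eq = refl
sumBelow-cong (suc k) eq = cong₂ _+_ (eq 0 z<s) (sumBelow-cong k (λ i i<k → eq (suc i) (s<s i<k)))

sumBelow-mono : ∀ k {f g : ℕ → ℕ} → (∀ i → i < k → f i ≤ g i) → sumBelow k f ≤ sumBelow k g
sumBelow-mono zero    le = z≤n
sumBelow-mono (suc k) le = +-mono-≤ (le 0 z<s) (sumBelow-mono k (λ i i<k → le (suc i) (s<s i<k)))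

sumBelow-distrib-+ : ∀ k (f g : ℕ → ℕ) → sumBelow k (λ i → f i + g i) ≡ sumBelow k f + sumBelow k g
sumBelow-distrib-+ zero    f g = refl
sumBelow-distrib-+ (suc k) f g =
  trans (cong (f 0 + g 0 +_) (sumBelow-distrib-+ k (f ∘ suc) (g ∘ suc))) (interchange (f 0) (g 0) _ _)

sumBelow-*ˡ : ∀ k c (f : ℕ → ℕ) → sumBelow k (λ i → c * f i) ≡ c * sumBelow k f
sumBelow-*ˡ zero    c f = sym (*-zeroʳ c)
sumBelow-*ˡ (suc k) c f =
  trans (cong (c * f 0 +_) (sumBelow-*ˡ k c (f ∘ suc))) (sym (*-distribˡ-+ c (f 0) _))

sumBelow-const : ∀ k c → sumBelow k (λ _ → c) ≡ k * c
sumBelow-const zero    c = refl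
sumBelow-const (suc k) c = cong (c +_) (sumBelow-const k c)

sumBelow-split : ∀ a b (f : ℕ → ℕ) → sumBelow (a + b) f ≡ sumBelow a f + sumBelow b (λ i → f (a + i))
sumBelow-split zero    b f = refl
sumBelow-split (suc a) b f =
  trans (cong (f 0 +_) (sumBelow-split a b (f ∘ suc))) (sym (+-assoc (f 0) _ _))

sumBelow-window : ∀ {n} lo k (f : ℕ → ℕ) → lo + k ≤ n → sumBelow k (λ i → f (lo + i)) ≤ sumBelow n f
sumBelow-window {n} lo k f lo+k≤n = begin
  sumBelow k (λ i → f (lo + i))                                    ≤⟨ m≤n+m _ (sumBelow lo f) ⟩
  sumBelow lo f + sumBelow k (λ i → f (lo + i))                    ≡⟨ sym (sumBelow-split lo k f) ⟩
  sumBelow (lo + k) f                                              ≤⟨ m≤m+n _ _ ⟩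
  sumBelow (lo + k) f + sumBelow (n ∸ (lo + k)) (λ i → f (lo + k + i)) ≡⟨ sym (sumBelow-split (lo + k) _ f) ⟩
  sumBelow (lo + k + (n ∸ (lo + k))) f                             ≡⟨ cong (λ m → sumBelow m f) (m+[n∸m]≡n lo+k≤n) ⟩
  sumBelow n f                                                     ∎
  where open ≤-Reasoning

sumBelow-term : ∀ {n} (f : ℕ → ℕ) {i} → i < n → f i ≤ sumBelow n f
sumBelow-term {suc n} f {zero}  _         = m≤m+n (f 0) _
sumBelow-term {suc n} f {suc i} (s<s i<n) = ≤-trans (sumBelow-term (f ∘ suc) i<n) (m≤n+m _ (f 0))

sumBelow-vanishing : ∀ k (f : ℕ → ℕ) → (∀ i → f i ≡ 0) → sumBelow k f ≡ 0
sumBelow-vanishing k f f≡0 = trans (sumBelow-cong k (λ i _ → f≡0 i)) (trans (sumBelow-const k 0) (*-zeroʳ k))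

sumBelow-support : ∀ k N (f : ℕ → ℕ) → (∀ i → N ≤ i → f i ≡ 0) → sumBelow k f ≤ sumBelow N f
sumBelow-support zero    N       f _ = z≤n
sumBelow-support (suc k) zero    f f≡0 = ≤-reflexive (sumBelow-vanishing (suc k) f (λ i → f≡0 i z≤n))
sumBelow-support (suc k) (suc N) f f≡0 =
  +-monoʳ-≤ (f 0) (sumBelow-support k N (f ∘ suc) (λ i N≤i → f≡0 (suc i) (s≤s N≤i)))

sumBelow-2^ : ∀ k → sumBelow k (2 ^_) < 2 ^ k
sumBelow-2^ zero    = z<s
sumBelow-2^ (suc k) = begin-strict
  1 + sumBelow k (λ i → 2 * 2 ^ i) ≡⟨ cong suc (sumBelow-*ˡ k 2 (2 ^_)) ⟩
  1 + 2 * sumBelow k (2 ^_)        <⟨ n<1+n _ ⟩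
  2 + 2 * sumBelow k (2 ^_)        ≡⟨ sym (*-suc 2 _) ⟩
  2 * suc (sumBelow k (2 ^_))      ≤⟨ *-monoʳ-≤ 2 (sumBelow-2^ k) ⟩
  2 * 2 ^ k                        ∎
  where open ≤-Reasoning

sumFin-cong : ∀ {m} {f g : Fin m → ℕ} → (∀ i → f i ≡ g i) → sumFin f ≡ sumFin g
sumFin-cong {zero}  eq = refl
sumFin-cong {suc m} eq = cong₂ _+_ (eq zero) (sumFin-cong (eq ∘ suc))

sumFin-mono : ∀ {m} {f g : Fin m → ℕ} → (∀ i → f i ≤ g i) → sumFin f ≤ sumFin g
sumFin-mono {zero}  le = z≤n
sumFin-mono {suc m} le = +-mono-≤ (le zero) (sumFin-mono (le ∘ suc))

sumFin-distrib-+ : ∀ {m} (f g : Fin m → ℕ) → sumFin (λ i → f i + g i) ≡ sumFin f + sumFin g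
sumFin-distrib-+ {zero}  f g = refl
sumFin-distrib-+ {suc m} f g =
  trans (cong (f zero + g zero +_) (sumFin-distrib-+ (f ∘ suc) (g ∘ suc))) (interchange (f zero) (g zero) _ _)

sumFin-*ˡ : ∀ {m} c (f : Fin m → ℕ) → sumFin (λ i → c * f i) ≡ c * sumFin f
sumFin-*ˡ {zero}  c f = sym (*-zeroʳ c)
sumFin-*ˡ {suc m} c f =
  trans (cong (c * f zero +_) (sumFin-*ˡ c (f ∘ suc))) (sym (*-distribˡ-+ c (f zero) _))

sumFin≡sumBelow : ∀ {m} (f : Fin m → ℕ) (g : ℕ → ℕ) → (∀ i → f i ≡ g (toℕ i)) → sumFin f ≡ sumBelow m g
sumFin≡sumBelow {zero}  f g eq = refl
sumFin≡sumBelow {suc m} f g eq = cong₂ _+_ (eq zero) (sumFin≡sumBelow (f ∘ suc) (g ∘ suc) (eq ∘ suc))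

sumFin-sumBelow-comm : ∀ {m} k (F : Fin m → ℕ → ℕ) →
  sumFin (λ i → sumBelow k (F i)) ≡ sumBelow k (λ j → sumFin (λ i → F i j))
sumFin-sumBelow-comm {m} zero F =
  trans (sumFin≡sumBelow {m} _ (λ _ → 0) (λ _ → refl)) (sumBelow-vanishing m _ (λ _ → refl))
sumFin-sumBelow-comm (suc k) F =
  trans (sumFin-distrib-+ (λ i → F i 0) (λ i → sumBelow k (F i ∘ suc)))
        (cong (sumFin (λ i → F i 0) +_) (sumFin-sumBelow-comm k (λ i j → F i (suc j))))

hamming≡sumFin : ∀ {m} (u v : Fin m → Bool) → hamming u v ≡ sumFin (λ i → diffBit (u i) (v i))
hamming≡sumFin {zero}  u v = refl
hamming≡sumFin {suc m} u v = cong (diffBit (u zero) (v zero) +_) (hamming≡sumFin (u ∘ suc) (v ∘ suc))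

-- Dyadic blocks

⌊n/2⌋+⌊n/2⌋≤n : ∀ n → ⌊ n /2⌋ + ⌊ n /2⌋ ≤ n
⌊n/2⌋+⌊n/2⌋≤n zero          = z≤n
⌊n/2⌋+⌊n/2⌋≤n (suc zero)    = z≤n
⌊n/2⌋+⌊n/2⌋≤n (suc (suc n)) rewrite +-suc ⌊ n /2⌋ ⌊ n /2⌋ = s≤s (s≤s (⌊n/2⌋+⌊n/2⌋≤n n))

n≤1+⌊n/2⌋+⌊n/2⌋ : ∀ n → n ≤ suc (⌊ n /2⌋ + ⌊ n /2⌋)
n≤1+⌊n/2⌋+⌊n/2⌋ zero          = z≤n
n≤1+⌊n/2⌋+⌊n/2⌋ (suc zero)    = s≤s z≤n
n≤1+⌊n/2⌋+⌊n/2⌋ (suc (suc n)) rewrite +-suc ⌊ n /2⌋ ⌊ n /2⌋ = s≤s (s≤s (n≤1+⌊n/2⌋+⌊n/2⌋ n))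

⌊n/2⌋-parity : ∀ n → n ≡ ⌊ n /2⌋ + ⌊ n /2⌋ ⊎ n ≡ suc (⌊ n /2⌋ + ⌊ n /2⌋)
⌊n/2⌋-parity n with m≤n⇒m<n∨m≡n (⌊n/2⌋+⌊n/2⌋≤n n)
... | inj₁ lt = inj₂ (≤-antisym (n≤1+⌊n/2⌋+⌊n/2⌋ n) lt)
... | inj₂ eq = inj₁ (sym eq)

n≡⌊n+[1+n]/2⌋ : ∀ n → n ≡ ⌊ n + suc n /2⌋
n≡⌊n+[1+n]/2⌋ zero    = refl
n≡⌊n+[1+n]/2⌋ (suc n) = trans (cong suc (n≡⌊n+[1+n]/2⌋ n)) (cong (λ m → ⌊ suc m /2⌋) (sym (+-suc n (suc n))))

2^-double : ∀ j → 2 ^ suc j ≡ 2 ^ j + 2 ^ j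
2^-double j = cong (2 ^ j +_) (+-identityʳ (2 ^ j))

-- block j x = ⌊ x / 2 ^ j ⌋, the index of the dyadic block of length 2 ^ j containing x
block : ℕ → ℕ → ℕ
block zero    x = x
block (suc j) x = block j ⌊ x /2⌋

block-suc : ∀ j x → block (suc j) x ≡ ⌊ block j x /2⌋
block-suc zero    x = refl
block-suc (suc j) x = block-suc j ⌊ x /2⌋

block-+ : ∀ j d x → block (j + d) x ≡ block d (block j x)
block-+ zero    d x = refl
block-+ (suc j) d x = block-+ j d ⌊ x /2⌋

block-cong-≤ : ∀ {j k x y} → j ≤ k → block j x ≡ block j y → block k x ≡ block k y
block-cong-≤ {j} {k} {x} {y} j≤k eq = begin
  block k x                   ≡⟨ cong (λ i → block i x) (sym (m+[n∸m]≡n j≤k)) ⟩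
  block (j + (k ∸ j)) x       ≡⟨ block-+ j (k ∸ j) x ⟩
  block (k ∸ j) (block j x)   ≡⟨ cong (block (k ∸ j)) eq ⟩
  block (k ∸ j) (block j y)   ≡⟨ sym (block-+ j (k ∸ j) y) ⟩
  block (j + (k ∸ j)) y       ≡⟨ cong (λ i → block i y) (m+[n∸m]≡n j≤k) ⟩
  block k y                   ∎
  where open ≡-Reasoning

block-offset : ∀ j t {s} → s < 2 ^ j → block j (t * 2 ^ j + s) ≡ t
block-offset zero    t {zero}  _ = trans (+-identityʳ (t * 1)) (*-identityʳ t)
block-offset zero    t {suc s} (s<s ())
block-offset (suc j) t {s} s<2^[1+j] = begin
  block j ⌊ t * 2 ^ suc j + s /2⌋
    ≡⟨ cong (λ z → block j ⌊ z + s /2⌋) (trans (cong (t *_) (2^-double j)) (*-distribˡ-+ t _ _)) ⟩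
  block j ⌊ (t * 2 ^ j + t * 2 ^ j) + s /2⌋
    ≡⟨ cong (block j) (halve-double (t * 2 ^ j) s) ⟩
  block j (t * 2 ^ j + ⌊ s /2⌋)
    ≡⟨ block-offset j t ⌊s/2⌋<2^j ⟩
  t ∎
  where
  open ≡-Reasoning
  halve-double : ∀ m s → ⌊ (m + m) + s /2⌋ ≡ m + ⌊ s /2⌋
  halve-double zero    s = refl
  halve-double (suc m) s rewrite +-suc m m = cong suc (halve-double m s)
  ⌊s/2⌋<2^j : ⌊ s /2⌋ < 2 ^ j
  ⌊s/2⌋<2^j with ⌊ s /2⌋ <? 2 ^ j
  ... | yes lt = lt
  ... | no  ≮ = ⊥-elim (<⇒≱ (subst (s <_) (2^-double j) s<2^[1+j])
                            (≤-trans (+-mono-≤ (≮⇒≥ ≮) (≮⇒≥ ≮)) (⌊n/2⌋+⌊n/2⌋≤n s)))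

block-lower : ∀ j n → block j n * 2 ^ j ≤ n
block-lower zero    n = ≤-reflexive (*-identityʳ n)
block-lower (suc j) n = begin
  block j ⌊ n /2⌋ * 2 ^ suc j
    ≡⟨ cong (block j ⌊ n /2⌋ *_) (2^-double j) ⟩
  block j ⌊ n /2⌋ * (2 ^ j + 2 ^ j)
    ≡⟨ *-distribˡ-+ (block j ⌊ n /2⌋) _ _ ⟩
  block j ⌊ n /2⌋ * 2 ^ j + block j ⌊ n /2⌋ * 2 ^ j
    ≤⟨ +-mono-≤ (block-lower j ⌊ n /2⌋) (block-lower j ⌊ n /2⌋) ⟩
  ⌊ n /2⌋ + ⌊ n /2⌋
    ≤⟨ ⌊n/2⌋+⌊n/2⌋≤n n ⟩
  n ∎
  where open ≤-Reasoning

block-upper : ∀ j n → n < suc (block j n) * 2 ^ j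
block-upper zero    n = ≤-reflexive (cong suc (sym (*-identityʳ n)))
block-upper (suc j) n = begin-strict
  n                                                  ≤⟨ n≤1+⌊n/2⌋+⌊n/2⌋ n ⟩
  suc (⌊ n /2⌋ + ⌊ n /2⌋)                            <⟨ n<1+n _ ⟩
  suc (suc (⌊ n /2⌋ + ⌊ n /2⌋))                      ≡⟨ cong suc (sym (+-suc ⌊ n /2⌋ ⌊ n /2⌋)) ⟩
  suc ⌊ n /2⌋ + suc ⌊ n /2⌋                          ≤⟨ +-mono-≤ (block-upper j ⌊ n /2⌋) (block-upper j ⌊ n /2⌋) ⟩
  b * 2 ^ j + b * 2 ^ j                              ≡⟨ sym (*-distribˡ-+ b (2 ^ j) (2 ^ j)) ⟩
  b * (2 ^ j + 2 ^ j)                                ≡⟨ cong (b *_) (sym (2^-double j)) ⟩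
  b * 2 ^ suc j                                      ∎
  where
  open ≤-Reasoning
  b = suc (block j ⌊ n /2⌋)

-- The level at which two numbers split, and the matrix

record Splits (G x y : ℕ) : Set where
  constructor splits
  field
    agree  : block (suc G) x ≡ block (suc G) y
    differ : block G x ≢ block G y

Splits-sym : ∀ {G x y} → Splits G x y → Splits G y x
Splits-sym (splits agree differ) = splits (sym agree) (differ ∘ sym)

Splits-halves : ∀ {G x y} → Splits G ⌊ x /2⌋ ⌊ y /2⌋ → Splits (suc G) x y
Splits-halves (splits agree differ) = splits agree differ

halves-< : ∀ x y → x ≢ y → ⌊ x /2⌋ + ⌊ y /2⌋ < x + y
halves-< zero    zero    x≢y = ⊥-elim (x≢y refl)
halves-< zero    (suc y) _   = ⌊n/2⌋<n y
halves-< (suc x) y       _   = +-mono-<-≤ (⌊n/2⌋<n x) (⌊n/2⌋≤n y)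

splitLevelWithin : ℕ → ℕ → ℕ → ℕ
splitLevelWithin zero    x y = 0
splitLevelWithin (suc k) x y with ⌊ x /2⌋ ≟ ⌊ y /2⌋
... | yes _ = 0
... | no  _ = suc (splitLevelWithin k ⌊ x /2⌋ ⌊ y /2⌋)

-- Halving decreases x + y, so x + y steps of fuel suffice.
splitLevel : ℕ → ℕ → ℕ
splitLevel x y = splitLevelWithin (x + y) x y

splitLevelWithin-splits : ∀ k x y → x + y ≤ k → x ≢ y → Splits (splitLevelWithin k x y) x y
splitLevelWithin-splits zero    zero zero _ x≢y = ⊥-elim (x≢y refl)
splitLevelWithin-splits (suc k) x y x+y≤1+k x≢y with ⌊ x /2⌋ ≟ ⌊ y /2⌋
... | yes halves≡ = splits halves≡ x≢y
... | no  halves≢ = Splits-halves (splitLevelWithin-splits k ⌊ x /2⌋ ⌊ y /2⌋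
                      (≤-pred (<-≤-trans (halves-< x y x≢y) x+y≤1+k)) halves≢)

splitLevel-splits : ∀ {x y} → x ≢ y → Splits (splitLevel x y) x y
splitLevel-splits {x} {y} = splitLevelWithin-splits (x + y) x y ≤-refl

splitLevel-unique : ∀ {G x y} → Splits G x y → splitLevel x y ≡ G
splitLevel-unique {G} {x} {y} (splits agree differ) = ≤-antisym (≮⇒≥ G≮S) (≮⇒≥ S≮G)
  where
  S = splitLevel x y
  S-splits : Splits S x y
  S-splits = splitLevel-splits (λ x≡y → differ (cong (block G) x≡y))
  S≮G : S ≮ G
  S≮G S<G = differ (block-cong-≤ S<G (Splits.agree S-splits))
  G≮S : G ≮ S
  G≮S G<S = Splits.differ S-splits (block-cong-≤ G<S agree)

splitLevel-sym : ∀ x y → splitLevel x y ≡ splitLevel y x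
splitLevel-sym x y with x ≟ y
... | yes refl = refl
... | no  x≢y  = sym (splitLevel-unique (Splits-sym (splitLevel-splits x≢y)))

splitLevel-halves : ∀ {x y} → ⌊ x /2⌋ ≢ ⌊ y /2⌋ → splitLevel x y ≡ suc (splitLevel ⌊ x /2⌋ ⌊ y /2⌋)
splitLevel-halves halves≢ = splitLevel-unique (Splits-halves (splitLevel-splits halves≢))

odd : ℕ → Bool
odd zero    = false
odd (suc n) = not (odd n)

entry : ℕ → ℕ → Bool
entry x y with x ≟ y
... | yes _ = true
... | no  _ = odd (splitLevel x y)

matrix : (n : ℕ) → BinMat n n
matrix n i j = entry (toℕ i) (toℕ j)

entry-diag : ∀ x → entry x x ≡ true
entry-diag x with x ≟ x
... | yes _   = refl
... | no  x≢x = ⊥-elim (x≢x refl)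

entry-offdiag : ∀ {x y} → x ≢ y → entry x y ≡ odd (splitLevel x y)
entry-offdiag {x} {y} x≢y with x ≟ y
... | yes x≡y = ⊥-elim (x≢y x≡y)
... | no  _   = refl

entry-sym : ∀ x y → entry x y ≡ entry y x
entry-sym x y = by-cases (x ≟ y)
  where
  by-cases : Dec (x ≡ y) → entry x y ≡ entry y x
  by-cases (yes x≡y) = cong₂ entry x≡y (sym x≡y)
  by-cases (no  x≢y) = trans (entry-offdiag x≢y)
    (trans (cong odd (splitLevel-sym x y)) (sym (entry-offdiag (x≢y ∘ sym))))

-- Lower bound on the Hamming coherence

diffBit-sym : ∀ a b → diffBit a b ≡ diffBit b a
diffBit-sym true  true  = refl
diffBit-sym true  false = refl
diffBit-sym false true  = refl
diffBit-sym false false = refl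

diffBit-self : ∀ a → diffBit a a ≡ 0
diffBit-self true  = refl
diffBit-self false = refl

diffBit-not : ∀ a → diffBit a (not a) ≡ 1
diffBit-not true  = refl
diffBit-not false = refl

rowDist : ℕ → ℕ → ℕ → ℕ
rowDist n x x' = sumBelow n (λ y → diffBit (entry x y) (entry x' y))

rowDist-sym : ∀ n x x' → rowDist n x x' ≡ rowDist n x' x
rowDist-sym n x x' = sumBelow-cong n (λ y _ → diffBit-sym (entry x y) (entry x' y))

sibling : ℕ → ℕ
sibling zero          = 1
sibling (suc zero)    = 0
sibling (suc (suc u)) = suc (suc (sibling u))

⌊sibling/2⌋ : ∀ u → ⌊ sibling u /2⌋ ≡ ⌊ u /2⌋
⌊sibling/2⌋ zero          = refl
⌊sibling/2⌋ (suc zero)    = refl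
⌊sibling/2⌋ (suc (suc u)) = cong suc (⌊sibling/2⌋ u)

sibling-≢ : ∀ u → sibling u ≢ u
sibling-≢ (suc (suc u)) eq = sibling-≢ u (suc-injective (suc-injective eq))

splits-siblingBlock : ∀ g x {s} → s < 2 ^ g → Splits g x (sibling (block g x) * 2 ^ g + s)
splits-siblingBlock g x {s} s<2^g = splits
  (begin
    block (suc g) x                 ≡⟨ block-suc g x ⟩
    ⌊ block g x /2⌋                 ≡⟨ sym (⌊sibling/2⌋ (block g x)) ⟩
    ⌊ sibling (block g x) /2⌋       ≡⟨ cong ⌊_/2⌋ (sym (block-offset g _ s<2^g)) ⟩
    ⌊ block g y /2⌋                 ≡⟨ sym (block-suc g y) ⟩
    block (suc g) y                 ∎)
  (λ eq → sibling-≢ (block g x) (sym (trans eq (block-offset g _ s<2^g))))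
  where
  open ≡-Reasoning
  y = sibling (block g x) * 2 ^ g + s

Splits-below : ∀ {g G x x' y} → g < G → Splits G x x' → Splits g x y → Splits G x' y
Splits-below g<G (splits agree differ) (splits agree' _) = splits
  (trans (sym agree) (block-cong-≤ (s≤s (<⇒≤ g<G)) agree'))
  (λ eq → differ (trans (block-cong-≤ g<G agree') (sym eq)))

entries-differ : ∀ {g x x' y} → Splits g x y → Splits (suc g) x' y → diffBit (entry x y) (entry x' y) ≡ 1
entries-differ {g} {x} {x'} {y} x-splits x'-splits = begin
  diffBit (entry x y) (entry x' y)
    ≡⟨ cong₂ diffBit (entry-offdiag (λ eq → Splits.differ x-splits (cong (block g) eq)))
                     (entry-offdiag (λ eq → Splits.differ x'-splits (cong (block (suc g)) eq))) ⟩
  diffBit (odd (splitLevel x y)) (odd (splitLevel x' y))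
    ≡⟨ cong₂ (λ a b → diffBit (odd a) (odd b)) (splitLevel-unique x-splits) (splitLevel-unique x'-splits) ⟩
  diffBit (odd g) (not (odd g))
    ≡⟨ diffBit-not (odd g) ⟩
  1 ∎
  where open ≡-Reasoning

siblingBlock-end : ∀ {g x x'} → block (suc g) x < block (suc g) x' → sibling (block g x) * 2 ^ g + 2 ^ g ≤ x'
siblingBlock-end {g} {x} {x'} lt = begin
  w * 2 ^ g + 2 ^ g      ≡⟨ +-comm (w * 2 ^ g) (2 ^ g) ⟩
  suc w * 2 ^ g          ≤⟨ *-monoˡ-≤ (2 ^ g) w<block ⟩
  block g x' * 2 ^ g     ≤⟨ block-lower g x' ⟩
  x'                     ∎
  where
  open ≤-Reasoning
  w = sibling (block g x)
  w<block : w < block g x'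
  w<block with w <? block g x'
  ... | yes w< = w<
  ... | no  w≮ = ⊥-elim (<⇒≱ lt (begin
        block (suc g) x'     ≡⟨ block-suc g x' ⟩
        ⌊ block g x' /2⌋      ≤⟨ ⌊n/2⌋-mono (≮⇒≥ w≮) ⟩
        ⌊ w /2⌋               ≡⟨ ⌊sibling/2⌋ (block g x) ⟩
        ⌊ block g x /2⌋       ≡⟨ sym (block-suc g x) ⟩
        block (suc g) x      ∎))

rowDist-split : ∀ {n G x x'} → x < n → x' < n → Splits G x x' → block G x < block G x' →
                2 ^ G ≤ 2 * rowDist n x x'
rowDist-split {n} {zero} {x} {x'} x<n _ x-splits-x' _ =
  ≤-trans (≤-trans (≤-reflexive (sym diagonal-differs)) (sumBelow-term _ x<n)) (m≤n*m _ 2)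
  where
  diagonal-differs : diffBit (entry x x) (entry x' x) ≡ 1
  diagonal-differs rewrite entry-diag x | entry-offdiag (Splits.differ x-splits-x' ∘ sym)
                         | splitLevel-unique (Splits-sym x-splits-x') = refl
rowDist-split {n} {suc g} {x} {x'} _ x'<n x-splits-x' lt = *-monoʳ-≤ 2 (begin
  2 ^ g                                ≡⟨ sym (trans (sumBelow-const (2 ^ g) 1) (*-identityʳ (2 ^ g))) ⟩
  sumBelow (2 ^ g) (λ _ → 1)           ≡⟨ sumBelow-cong (2 ^ g) (λ s s< → sym (entries-differ (splits-siblingBlock g x s<)
                                            (Splits-below ≤-refl x-splits-x' (splits-siblingBlock g x s<)))) ⟩
  sumBelow (2 ^ g) (λ s → D (lo + s))  ≤⟨ sumBelow-window lo (2 ^ g) D (≤-trans (siblingBlock-end {g} lt) (<⇒≤ x'<n)) ⟩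
  rowDist n x x'                       ∎)
  where
  open ≤-Reasoning
  lo = sibling (block g x) * 2 ^ g
  D : ℕ → ℕ
  D y = diffBit (entry x y) (entry x' y)

indicator : Bool → ℕ
indicator true  = 1
indicator false = 0

diffBit≤indicator+indicator : ∀ a b → diffBit a b ≤ indicator a + indicator b
diffBit≤indicator+indicator true  true  = z≤n
diffBit≤indicator+indicator true  false = ≤-refl
diffBit≤indicator+indicator false true  = ≤-refl
diffBit≤indicator+indicator false false = z≤n

sumBelow-indicator-≡ : ∀ k a → sumBelow k (λ v → indicator (does (a ≟ v))) ≤ 1
sumBelow-indicator-≡ zero    a       = z≤n
sumBelow-indicator-≡ (suc k) zero    = s≤s (≤-reflexive (sumBelow-vanishing k _ (λ _ → refl)))
sumBelow-indicator-≡ (suc k) (suc a) = sumBelow-indicator-≡ k a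

inBlock : ℕ → ℕ → ℕ → Bool
inBlock j v x = does (block j x ≟ v)

levelDist : ℕ → ℕ → ℕ → ℕ → ℕ
levelDist n j x x' = sumBelow (block j n) (λ v → diffBit (inBlock j v x) (inBlock j v x'))

levelDist≤2 : ∀ n j x x' → levelDist n j x x' ≤ 2
levelDist≤2 n j x x' = begin
  levelDist n j x x'
    ≤⟨ sumBelow-mono (block j n) (λ v _ → diffBit≤indicator+indicator (inBlock j v x) (inBlock j v x')) ⟩
  sumBelow (block j n) (λ v → indicator (inBlock j v x) + indicator (inBlock j v x'))
    ≡⟨ sumBelow-distrib-+ (block j n) _ _ ⟩
  sumBelow (block j n) (indicator ∘ (λ v → inBlock j v x)) + sumBelow (block j n) (indicator ∘ (λ v → inBlock j v x'))
    ≤⟨ +-mono-≤ (sumBelow-indicator-≡ (block j n) (block j x)) (sumBelow-indicator-≡ (block j n) (block j x')) ⟩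
  2 ∎
  where open ≤-Reasoning

levelDist-sameBlock : ∀ n j {x x'} → block j x ≡ block j x' → levelDist n j x x' ≡ 0
levelDist-sameBlock n j {x} eq = sumBelow-vanishing (block j n) _
  (λ v → trans (cong (λ b → diffBit (inBlock j v x) (does (b ≟ v))) (sym eq)) (diffBit-self _))

levelDist-sym : ∀ n j x x' → levelDist n j x x' ≡ levelDist n j x' x
levelDist-sym n j x x' = sumBelow-cong (block j n) (λ v _ → diffBit-sym (inBlock j v x) (inBlock j v x'))

-- The charge of an adjacent pair x, x': 2 ^ j for each level-j block containing exactly one of them.
potential : ℕ → ℕ → ℕ → ℕ → ℕ
potential K n x x' = sumBelow K (λ j → 2 ^ j * levelDist n j x x')

charge-sameBlock : ∀ n j {x x'} → block j x ≡ block j x' → 2 ^ j * levelDist n j x x' ≡ 0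
charge-sameBlock n j eq = trans (cong (2 ^ j *_) (levelDist-sameBlock n j eq)) (*-zeroʳ (2 ^ j))

potential-sym : ∀ K n x x' → potential K n x x' ≡ potential K n x' x
potential-sym K n x x' = sumBelow-cong K (λ j _ → cong (2 ^ j *_) (levelDist-sym n j x x'))

potential-sameBlock : ∀ K n G {x x'} → block G x ≡ block G x' → potential K n x x' < 2 * 2 ^ G
potential-sameBlock K n G {x} {x'} eq = begin-strict
  potential K n x x'
    ≤⟨ sumBelow-support K G _ (λ j G≤j → charge-sameBlock n j (block-cong-≤ G≤j eq)) ⟩
  sumBelow G (λ j → 2 ^ j * levelDist n j x x')
    ≤⟨ sumBelow-mono G (λ j _ → *-monoʳ-≤ (2 ^ j) (levelDist≤2 n j x x')) ⟩
  sumBelow G (λ j → 2 ^ j * 2)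
    ≡⟨ sumBelow-cong G (λ j _ → *-comm (2 ^ j) 2) ⟩
  sumBelow G (λ j → 2 * 2 ^ j)
    ≡⟨ sumBelow-*ˡ G 2 (2 ^_) ⟩
  2 * sumBelow G (2 ^_)
    <⟨ *-monoʳ-< 2 (sumBelow-2^ G) ⟩
  2 * 2 ^ G ∎
  where open ≤-Reasoning

potential≤8*rowDist-ordered : ∀ K {n G x x'} → x < n → x' < n → Splits G x x' → block G x < block G x' →
                              potential K n x x' ≤ 8 * rowDist n x x'
potential≤8*rowDist-ordered K {n} {G} {x} {x'} x<n x'<n x-splits lt = begin
  potential K n x x'              ≤⟨ <⇒≤ (potential-sameBlock K n (suc G) (Splits.agree x-splits)) ⟩
  2 * (2 * 2 ^ G)                 ≤⟨ *-monoʳ-≤ 2 (*-monoʳ-≤ 2 (rowDist-split x<n x'<n x-splits lt)) ⟩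
  2 * (2 * (2 * rowDist n x x'))  ≡⟨ trans (sym (*-assoc 2 2 (2 * rowDist n x x'))) (sym (*-assoc 4 2 (rowDist n x x'))) ⟩
  8 * rowDist n x x'              ∎
  where open ≤-Reasoning

potential≤8*rowDist : ∀ K {n x x'} → x < n → x' < n → potential K n x x' ≤ 8 * rowDist n x x'
potential≤8*rowDist K {n} {x} {x'} x<n x'<n with x ≟ x'
... | yes x≡x' = ≤-trans (≤-reflexive (sumBelow-vanishing K _ (λ j → charge-sameBlock n j (cong (block j) x≡x')))) z≤n
... | no  x≢x' with <-cmp (block (splitLevel x x') x) (block (splitLevel x x') x')
... | tri< lt _ _ = potential≤8*rowDist-ordered K x<n x'<n (splitLevel-splits x≢x') lt
... | tri≈ _ eq _ = ⊥-elim (Splits.differ (splitLevel-splits x≢x') eq)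
... | tri> _ _ gt = subst₂ _≤_ (potential-sym K n x' x) (cong (8 *_) (rowDist-sym n x' x))
                      (potential≤8*rowDist-ordered K x'<n x<n (Splits-sym (splitLevel-splits x≢x')) gt)

changes : ∀ {m} → (Fin (suc m) → Bool) → ℕ
changes {m} s = sumFin {m} (λ i → diffBit (s (inject₁ i)) (s (suc i)))

diffBit-≢ : ∀ {a b} → a ≢ b → diffBit a b ≡ 1
diffBit-≢ {true}  {true}  a≢b = ⊥-elim (a≢b refl)
diffBit-≢ {true}  {false} _   = refl
diffBit-≢ {false} {true}  _   = refl
diffBit-≢ {false} {false} a≢b = ⊥-elim (a≢b refl)

changes-nonconstant : ∀ {m} (s : Fin (suc m) → Bool) {a b} → s a ≢ s b → 0 < changes s
changes-nonconstant {zero}  s {zero} {zero} sa≢sb = ⊥-elim (sa≢sb refl)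
changes-nonconstant {suc m} s {a} {b} sa≢sb with s zero ≟ᴮ s (suc zero)
... | no  s0≢s1 = ≤-trans (≤-reflexive (sym (diffBit-≢ s0≢s1))) (m≤m+n _ _)
... | yes s0≡s1 = ≤-trans (changes-nonconstant (s ∘ suc) {tail a} {tail b}
                            (λ eq → sa≢sb (trans (sym (s-tail a)) (trans eq (s-tail b))))) (m≤n+m _ _)
  where
  tail : Fin (suc (suc m)) → Fin (suc m)
  tail zero    = zero
  tail (suc k) = k
  s-tail : ∀ k → s (suc (tail k)) ≡ s k
  s-tail zero    = sym s0≡s1
  s-tail (suc k) = refl

⌊log₂block⌋ : ∀ j n → ⌊log₂ (block j n) ⌋ ≡ ⌊log₂ n ⌋ ∸ j
⌊log₂block⌋ zero    n = refl
⌊log₂block⌋ (suc j) n = begin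
  ⌊log₂ (block j ⌊ n /2⌋) ⌋   ≡⟨ ⌊log₂block⌋ j ⌊ n /2⌋ ⟩
  ⌊log₂ ⌊ n /2⌋ ⌋ ∸ j         ≡⟨ cong (_∸ j) (⌊log₂⌊n/2⌋⌋≡⌊log₂n⌋∸1 n) ⟩
  ⌊log₂ n ⌋ ∸ 1 ∸ j           ≡⟨ ∸-+-assoc ⌊log₂ n ⌋ 1 j ⟩
  ⌊log₂ n ⌋ ∸ suc j           ∎
  where open ≡-Reasoning

1<block : ∀ {j n} → j < ⌊log₂ n ⌋ → 1 < block j n
1<block {j} {n} j<K with 1 <? block j n
... | yes 1<b = 1<b
... | no  1≮b = ⊥-elim (<⇒≱ (m<n⇒0<n∸m j<K) (begin
      ⌊log₂ n ⌋ ∸ j          ≡⟨ sym (⌊log₂block⌋ j n) ⟩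
      ⌊log₂ (block j n) ⌋    ≤⟨ ⌊log₂⌋-mono-≤ (≮⇒≥ 1≮b) ⟩
      0                      ∎))
  where open ≤-Reasoning

n≤2*2^j*block : ∀ j n → 0 < block j n → n ≤ 2 * (2 ^ j * block j n)
n≤2*2^j*block j n 0<b = begin
  n                            ≤⟨ <⇒≤ (block-upper j n) ⟩
  suc (block j n) * 2 ^ j      ≤⟨ *-monoˡ-≤ (2 ^ j) (+-monoˡ-≤ (block j n) 0<b) ⟩
  (block j n + block j n) * 2 ^ j ≡⟨ rearrange (block j n) (2 ^ j) ⟩
  2 * (2 ^ j * block j n)      ∎
  where
  open ≤-Reasoning
  rearrange : ∀ b c → (b + b) * c ≡ 2 * (c * b)
  rearrange = solve-∀

block-start : ∀ j {n t} → t < block j n → t * 2 ^ j < n × block j (t * 2 ^ j) ≡ t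
block-start j {n} {t} t<b = start<n , trans (cong (block j) (sym (+-identityʳ _))) (block-offset j t (m^n>0 2 j))
  where
  open ≤-Reasoning
  start<n : t * 2 ^ j < n
  start<n = begin-strict
    t * 2 ^ j               <⟨ m<n+m (t * 2 ^ j) (m^n>0 2 j) ⟩
    suc t * 2 ^ j           ≤⟨ *-monoˡ-≤ (2 ^ j) t<b ⟩
    block j n * 2 ^ j       ≤⟨ block-lower j n ⟩
    n                       ∎

another : ℕ → ℕ
another zero    = 1
another (suc _) = 0

another≢ : ∀ v → another v ≢ v
another≢ zero    ()
another≢ (suc _) ()

another≤1 : ∀ v → another v ≤ 1
another≤1 zero    = ≤-refl
another≤1 (suc _) = z≤n

n*⌊log₂n⌋≤2*weightedBlocks : ∀ n → n * ⌊log₂ n ⌋ ≤ 2 * sumBelow ⌊log₂ n ⌋ (λ j → 2 ^ j * block j n)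
n*⌊log₂n⌋≤2*weightedBlocks n = begin
  n * K
    ≡⟨ trans (*-comm n K) (sym (sumBelow-const K n)) ⟩
  sumBelow K (λ _ → n)
    ≤⟨ sumBelow-mono K (λ j j<K → n≤2*2^j*block j n (<-trans z<s (1<block {j} {n} j<K))) ⟩
  sumBelow K (λ j → 2 * (2 ^ j * block j n))
    ≡⟨ sumBelow-*ˡ K 2 _ ⟩
  2 * sumBelow K (λ j → 2 ^ j * block j n) ∎
  where
  open ≤-Reasoning
  K = ⌊log₂ n ⌋

module _ {m} (π : Permutation′ (suc m)) where

  private
    n = suc m
    K = ⌊log₂ n ⌋
    σ : Fin n → ℕ
    σ i = toℕ (π ⟨$⟩ʳ i)

  row-in-block : ∀ j {t} → t < block j n → Σ (Fin n) λ i → block j (σ i) ≡ t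
  row-in-block j t<b with block-start j t<b
  ... | start<n , block≡t = π ⟨$⟩ˡ fromℕ< start<n ,
    trans (cong (block j) (trans (cong toℕ (inverseʳ π)) (toℕ-fromℕ< start<n))) block≡t

  block-indicator-nonconstant : ∀ j {v} → 1 < block j n → v < block j n → 0 < changes (λ i → inBlock j v (σ i))
  block-indicator-nonconstant j {v} 1<b v<b
    with row-in-block j v<b | row-in-block j (≤-<-trans (another≤1 v) 1<b)
  ... | a , a∈v | b , b∈another = changes-nonconstant _ {a} {b}
    (λ eq → not-¬ (dec-true (block j (σ a) ≟ v) a∈v)
                  (trans eq (dec-false (block j (σ b) ≟ v) (λ b∈v → another≢ v (trans (sym b∈another) b∈v)))))

  block≤levelChanges : ∀ j → 1 < block j n → block j n ≤ sumFin {m} (λ i → levelDist n j (σ (inject₁ i)) (σ (suc i)))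
  block≤levelChanges j 1<b = begin
    block j n
      ≡⟨ sym (trans (sumBelow-const (block j n) 1) (*-identityʳ _)) ⟩
    sumBelow (block j n) (λ _ → 1)
      ≤⟨ sumBelow-mono (block j n) (λ v → block-indicator-nonconstant j 1<b) ⟩
    sumBelow (block j n) (λ v → changes (λ i → inBlock j v (σ i)))
      ≡⟨ sym (sumFin-sumBelow-comm {m} (block j n) _) ⟩
    sumFin (λ i → levelDist n j (σ (inject₁ i)) (σ (suc i))) ∎
    where open ≤-Reasoning

  weightedBlocks≤potentials : sumBelow K (λ j → 2 ^ j * block j n) ≤
                              sumFin {m} (λ i → potential K n (σ (inject₁ i)) (σ (suc i)))
  weightedBlocks≤potentials = begin
    sumBelow K (λ j → 2 ^ j * block j n)
      ≤⟨ sumBelow-mono K (λ j j<K → *-monoʳ-≤ (2 ^ j) (block≤levelChanges j (1<block {j} {n} j<K))) ⟩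
    sumBelow K (λ j → 2 ^ j * sumFin (λ i → levelDist n j (σ (inject₁ i)) (σ (suc i))))
      ≡⟨ sumBelow-cong K (λ j _ → sym (sumFin-*ˡ {m} (2 ^ j) _)) ⟩
    sumBelow K (λ j → sumFin (λ i → 2 ^ j * levelDist n j (σ (inject₁ i)) (σ (suc i))))
      ≡⟨ sym (sumFin-sumBelow-comm {m} K _) ⟩
    sumFin (λ i → potential K n (σ (inject₁ i)) (σ (suc i))) ∎
    where open ≤-Reasoning

  rowHammingSum-lower-bound : (N : BinMat n n) → (∀ i j → N i j ≡ entry (toℕ i) (toℕ j)) →
                              n * ⌊log₂ n ⌋ ≤ 16 * rowHammingSum π N
  rowHammingSum-lower-bound N N≡entry = begin
    n * K
      ≤⟨ n*⌊log₂n⌋≤2*weightedBlocks n ⟩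
    2 * sumBelow K (λ j → 2 ^ j * block j n)
      ≤⟨ *-monoʳ-≤ 2 weightedBlocks≤potentials ⟩
    2 * sumFin (λ i → potential K n (x i) (x' i))
      ≤⟨ *-monoʳ-≤ 2 (sumFin-mono {m} (λ i → potential≤8*rowDist K (σ<n (inject₁ i)) (σ<n (suc i)))) ⟩
    2 * sumFin (λ i → 8 * rowDist n (x i) (x' i))
      ≡⟨ cong (2 *_) (trans (sumFin-*ˡ {m} 8 _) (cong (8 *_) (sym cost≡))) ⟩
    2 * (8 * rowHammingSum π N)
      ≡⟨ sym (*-assoc 2 8 (rowHammingSum π N)) ⟩
    16 * rowHammingSum π N ∎
    where
    open ≤-Reasoning
    x x' : Fin m → ℕ
    x  i = σ (inject₁ i)
    x' i = σ (suc i)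
    σ<n : ∀ i → σ i < n
    σ<n i = toℕ<n (π ⟨$⟩ʳ i)
    hamming≡rowDist : ∀ a b → hamming (N a) (N b) ≡ rowDist n (toℕ a) (toℕ b)
    hamming≡rowDist a b = trans (hamming≡sumFin (N a) (N b))
      (sumFin≡sumBelow _ (λ y → diffBit (entry (toℕ a) y) (entry (toℕ b) y))
                         (λ y → cong₂ diffBit (N≡entry a y) (N≡entry b y)))
    cost≡ : rowHammingSum π N ≡ sumFin (λ i → rowDist n (x i) (x' i))
    cost≡ = sumFin-cong (λ i → hamming≡rowDist (π ⟨$⟩ʳ inject₁ i) (π ⟨$⟩ʳ suc i))

-- A merge sequence of width 3

squash-< : ∀ {X : Set} {r} (_∙_ : X → X → X) (f : Fin (suc (suc r)) → X) {i j : Fin (suc r)} →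
           toℕ j < toℕ i → squash _∙_ f i j ≡ f (inject₁ j)
squash-< {r = suc r} _∙_ f {suc i} {zero}  _         = refl
squash-< {r = suc r} _∙_ f {suc i} {suc j} (s<s j<i) = squash-< _∙_ (f ∘ suc) j<i

squash-≡ : ∀ {X : Set} {r} (_∙_ : X → X → X) (f : Fin (suc (suc r)) → X) (i : Fin (suc r)) →
           squash _∙_ f i i ≡ f (inject₁ i) ∙ f (suc i)
squash-≡             _∙_ f zero    = refl
squash-≡ {r = suc r} _∙_ f (suc i) = squash-≡ _∙_ (f ∘ suc) i

squash-> : ∀ {X : Set} {r} (_∙_ : X → X → X) (f : Fin (suc (suc r)) → X) {i j : Fin (suc r)} →
           toℕ i < toℕ j → squash _∙_ f i j ≡ f (suc j)
squash-> {r = suc r} _∙_ f {zero}  {suc j} _         = refl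
squash-> {r = suc r} _∙_ f {suc i} {suc j} (s<s i<j) = squash-> _∙_ (f ∘ suc) i<j

squash-pointwise : ∀ {X K : Set} {r} (_∙_ : X → X → X) (F : Fin (suc (suc r)) → K → X) (i j : Fin (suc r)) k →
                   squash (λ u v k → u k ∙ v k) F i j k ≡ squash _∙_ (λ l → F l k) i j
squash-pointwise             _∙_ F zero    zero    k = refl
squash-pointwise             _∙_ F zero    (suc j) k = refl
squash-pointwise {r = suc r} _∙_ F (suc i) zero    k = refl
squash-pointwise {r = suc r} _∙_ F (suc i) (suc j) k = squash-pointwise _∙_ (F ∘ suc) i j k

⊓-idem-just : ∀ v → just v ⊓ just v ≡ just v
⊓-idem-just true  = refl
⊓-idem-just false = refl

-- During the merge sequence at level L, the current lines (rows, say) are level-L indices that are still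
-- single, and pairs p that stand for the merged level-L lines 2p and 2p + 1, i.e. for the level-(L + 1) index p.
data Line : Set where
  pair   : ℕ → Line
  single : ℕ → Line

line : ℕ → ℕ → Line
line a r with r <? a
... | yes _ = pair r
... | no  _ = single (a + r)

line-< : ∀ {a r} → r < a → line a r ≡ pair r
line-< {a} {r} r<a with r <? a
... | yes _   = refl
... | no  r≮a = ⊥-elim (r≮a r<a)

line-≥ : ∀ {a r} → a ≤ r → line a r ≡ single (a + r)
line-≥ {a} {r} a≤r with r <? a
... | yes r<a = ⊥-elim (<⇒≱ r<a a≤r)
... | no  _   = refl

Separated : Line → Line → Set
Separated (pair p)   (pair q)   = p ≢ q
Separated (pair p)   (single y) = p ≢ ⌊ y /2⌋
Separated (single x) (pair q)   = ⌊ x /2⌋ ≢ q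
Separated (single x) (single y) = x ≢ y

value : ℕ → Line → Line → Bool
value L (pair p)   (pair q)   = odd (suc L + splitLevel p q)
value L (pair p)   (single y) = odd (suc L + splitLevel p ⌊ y /2⌋)
value L (single x) (pair q)   = odd (suc L + splitLevel ⌊ x /2⌋ q)
value L (single x) (single y) = odd (L + splitLevel x y)

Separated-sym : ∀ l l' → Separated l l' → Separated l' l
Separated-sym (pair _)   (pair _)   sep = sep ∘ sym
Separated-sym (pair _)   (single _) sep = sep ∘ sym
Separated-sym (single _) (pair _)   sep = sep ∘ sym
Separated-sym (single _) (single _) sep = sep ∘ sym

value-sym : ∀ L l l' → value L l l' ≡ value L l' l
value-sym L (pair p)   (pair q)   = cong (λ s → odd (suc L + s)) (splitLevel-sym p q)
value-sym L (pair p)   (single y) = cong (λ s → odd (suc L + s)) (splitLevel-sym p ⌊ y /2⌋)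
value-sym L (single x) (pair q)   = cong (λ s → odd (suc L + s)) (splitLevel-sym ⌊ x /2⌋ q)
value-sym L (single x) (single y) = cong (λ s → odd (L + s)) (splitLevel-sym x y)

single-inherits : ∀ L {x p} → ⌊ x /2⌋ ≡ p → ∀ l → Separated (pair p) l →
                  Separated (single x) l × value L (single x) l ≡ value L (pair p) l
single-inherits L {x} refl (pair q)   sep = sep , refl
single-inherits L {x} refl (single y) sep =
  (λ x≡y → sep (cong ⌊_/2⌋ x≡y)) ,
  cong odd (trans (cong (L +_) (splitLevel-halves sep)) (+-suc L _))

-- The entries of A between separated lines are those of the level-L matrix; all others may be ⊥.
Contracted : ∀ {R C} → ℕ → ℕ → ℕ → SMat R C → Set
Contracted L a b A = ∀ r c {l l'} → line a (toℕ r) ≡ l → line b (toℕ c) ≡ l' → Separated l l' →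
                     A r c ≡ just (value L l l')

Contracted-transpose : ∀ {R C L a b} {A : SMat R C} → Contracted L a b A → Contracted L b a (λ c r → A r c)
Contracted-transpose {L = L} contracted c r {l} {l'} el el' sep =
  trans (contracted r c el' el (Separated-sym l l' sep)) (cong just (value-sym L l' l))

rowMerge-contracted : ∀ {R C L a b} (A : SMat (suc (suc R)) C) (i : Fin (suc R)) → toℕ i ≡ a →
                      Contracted L a b A → Contracted L (suc a) b (mergeRows A i)
rowMerge-contracted {L = L} A i refl contracted r c {l} {l'} el el' sep with <-cmp (toℕ r) (toℕ i)
... | tri< r<i _ _ = trans (cong (λ row → row c) (squash-< _ A r<i))
  (contracted (inject₁ r) c (trans (cong (line a) (toℕ-inject₁ r))
                            (trans (line-< r<i) (trans (sym (line-< (m<n⇒m<1+n r<i))) el))) el' sep)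
  where a = toℕ i
... | tri> _ _ i<r = trans (cong (λ row → row c) (squash-> _ A i<r))
  (contracted (suc r) c (trans (line-≥ (m≤n⇒m≤1+n (<⇒≤ i<r)))
                        (trans (cong single (+-suc (toℕ i) (toℕ r))) (trans (sym (line-≥ i<r)) el))) el' sep)
... | tri≈ _ r≡i _ with toℕ-injective r≡i | trans (sym el) (line-< (s≤s (≤-reflexive r≡i)))
...   | refl | refl = begin
  mergeRows A r r c
    ≡⟨ cong (λ row → row c) (squash-≡ _ A r) ⟩
  A (inject₁ r) c ⊓ A (suc r) c
    ≡⟨ cong₂ _⊓_ (from-single (trans (cong (line a) (toℕ-inject₁ r)) (line-≥ ≤-refl)) (sym (n≡⌊n+n/2⌋ a)))
                 (from-single (line-≥ (n≤1+n a)) (sym (n≡⌊n+[1+n]/2⌋ a))) ⟩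
  just (value L (pair a) l') ⊓ just (value L (pair a) l')
    ≡⟨ ⊓-idem-just _ ⟩
  just (value L (pair a) l') ∎
  where
  open ≡-Reasoning
  a = toℕ r
  from-single : ∀ {k x} → line a (toℕ k) ≡ single x → ⌊ x /2⌋ ≡ a → A k c ≡ just (value L (pair a) l')
  from-single {k} ek half≡a with single-inherits L half≡a l' sep
  ... | sep' , value≡ = trans (contracted k c ek el' sep') (cong just value≡)

colMerge-contracted : ∀ {R C L a b} (A : SMat R (suc (suc C))) (i : Fin (suc C)) → toℕ i ≡ b →
                      Contracted L a b A → Contracted L a (suc b) (mergeCols A i)
colMerge-contracted A i i≡b contracted r c el el' sep =
  trans (sym (squash-pointwise _⊓_ (λ k r → A r k) i c r))
        (Contracted-transpose (rowMerge-contracted (λ k r → A r k) i i≡b (Contracted-transpose contracted)) r c el el' sep)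

isError : Sym → ℕ
isError nothing  = 1
isError (just _) = 0

errs≡sumFin : ∀ {m} (f : Fin m → Sym) → errs f ≡ sumFin (isError ∘ f)
errs≡sumFin {zero}  f = refl
errs≡sumFin {suc m} f with f zero
... | nothing = cong suc (errs≡sumFin (f ∘ suc))
... | just _  = errs≡sumFin (f ∘ suc)

count : List ℕ → ℕ → ℕ
count []      y = 0
count (e ∷ E) y = indicator (does (e ≟ y)) + count E y

isError≤count : ∀ E {y s} → (y ∉ E → s ≢ nothing) → isError s ≤ count E y
isError≤count []      {s = nothing} defined = ⊥-elim (defined (λ ()) refl)
isError≤count []      {s = just _}  defined = z≤n
isError≤count (e ∷ E) {y} {s} defined with e ≟ y
... | yes e≡y = ≤-trans (isError≤1 s)
                  (subst (λ b → 1 ≤ indicator b + count E y) (sym (dec-true (e ≟ y) e≡y)) (m≤m+n 1 (count E y)))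
  where
  isError≤1 : ∀ s → isError s ≤ 1
  isError≤1 nothing  = ≤-refl
  isError≤1 (just _) = z≤n
... | no  e≢y = ≤-trans (isError≤count E defined-off-E) (m≤n+m _ _)
  where
  defined-off-E : y ∉ E → s ≢ nothing
  defined-off-E y∉E = defined λ { (here y≡e) → e≢y (sym y≡e) ; (there y∈E) → y∉E y∈E }

sumBelow-count : ∀ m E → sumBelow m (count E) ≤ length E
sumBelow-count m []      = ≤-reflexive (sumBelow-vanishing m _ (λ _ → refl))
sumBelow-count m (e ∷ E) = begin
  sumBelow m (count (e ∷ E))                                            ≡⟨ sumBelow-distrib-+ m _ _ ⟩
  sumBelow m (λ y → indicator (does (e ≟ y))) + sumBelow m (count E)
    ≤⟨ +-mono-≤ (sumBelow-indicator-≡ m e) (sumBelow-count m E) ⟩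
  suc (length E)                                                        ∎
  where open ≤-Reasoning

errs≤length : ∀ {m} (f : Fin m → Sym) E → (∀ c → toℕ c ∉ E → f c ≢ nothing) → errs f ≤ length E
errs≤length {m} f E defined = begin
  errs f                          ≡⟨ errs≡sumFin f ⟩
  sumFin (isError ∘ f)            ≤⟨ sumFin-mono {m} (λ c → isError≤count E (defined c)) ⟩
  sumFin {m} (λ c → count E (toℕ c)) ≡⟨ sumFin≡sumBelow {m} _ (count E) (λ _ → refl) ⟩
  sumBelow m (count E)            ≤⟨ sumBelow-count m E ⟩
  length E                        ∎
  where open ≤-Reasoning

-- The positions c whose line (after b merges) is not separated from l; the subtractions may truncate, which only
-- adds a harmless position 0.
entangled : ℕ → Line → List ℕ
entangled b (pair p)   = p ∷ (p + p) ∸ b ∷ suc (p + p) ∸ b ∷ []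
entangled b (single x) = ⌊ x /2⌋ ∷ x ∸ b ∷ []

length-entangled : ∀ b l → length (entangled b l) ≤ 3
length-entangled b (pair _)   = ≤-refl
length-entangled b (single _) = n≤1+n 2

separated-from : ∀ b l {c l'} → c ∉ entangled b l → line b c ≡ l' → Separated l l'
separated-from b l {c} {l'} c∉ e = by-cases (c <? b)
  where
  c≡[b+c]∸b : ∀ {z} → b + c ≡ z → c ≡ z ∸ b
  c≡[b+c]∸b refl = sym (m+n∸m≡n b c)
  from-pair : ∀ l → c ∉ entangled b l → Separated l (pair c)
  from-pair (pair p)   c∉ p≡c = c∉ (here (sym p≡c))
  from-pair (single x) c∉ eq  = c∉ (here (sym eq))
  from-single : ∀ l → c ∉ entangled b l → Separated l (single (b + c))
  from-single (pair p)   c∉ refl with ⌊n/2⌋-parity (b + c)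
  ... | inj₁ even = c∉ (there (here (c≡[b+c]∸b even)))
  ... | inj₂ odd  = c∉ (there (there (here (c≡[b+c]∸b odd))))
  from-single (single x) c∉ x≡b+c = c∉ (there (here (c≡[b+c]∸b (sym x≡b+c))))
  by-cases : Dec (c < b) → Separated l l'
  by-cases (yes c<b) = subst (Separated l) (trans (sym (line-< c<b)) e) (from-pair l c∉)
  by-cases (no  c≮b) = subst (Separated l) (trans (sym (line-≥ (≮⇒≥ c≮b))) e) (from-single l c∉)

contracted-bounded : ∀ {R C L a b} {A : SMat R C} → Contracted L a b A → Bounded 3 A
contracted-bounded contracted = rows-bounded contracted , rows-bounded (Contracted-transpose contracted)
  where
  rows-bounded : ∀ {R C L a b} {A : SMat R C} → Contracted L a b A → ∀ r → errs (A r) ≤ 3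
  rows-bounded {a = a} {b} {A} contracted r =
    ≤-trans (errs≤length (A r) (entangled b (line a (toℕ r)))
              (λ c c∉ undefined → just≢nothing (trans (sym (contracted r c refl refl (separated-from b _ c∉ refl))) undefined)))
            (length-entangled b (line a (toℕ r)))
    where
    just≢nothing : ∀ {v : Bool} → just v ≢ nothing
    just≢nothing ()

line-≤ : ∀ {a x} → x ≤ a → line a x ≡ pair x ⊎ (x ≡ a × line a x ≡ single (a + a))
line-≤ x≤a with m≤n⇒m<n∨m≡n x≤a
... | inj₁ x<a  = inj₁ (line-< x<a)
... | inj₂ refl = inj₂ (refl , line-≥ ≤-refl)

-- Once at most one single line is left, the pairs and that single line are the lines of the next level.
promote : ∀ {R L a} (A : SMat (suc R) (suc R)) → R ≤ a → Contracted L a a A → Contracted (suc L) 0 0 A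
promote {L = L} {a} A R≤a contracted r c el el' sep
  with trans (sym el) (line-≥ z≤n) | trans (sym el') (line-≥ z≤n)
... | refl | refl = by-cases (line-≤ (≤-trans (≤-pred (toℕ<n r)) R≤a)) (line-≤ (≤-trans (≤-pred (toℕ<n c)) R≤a))
  where
  x = toℕ r
  y = toℕ c
  ⌊a+a/2⌋≡ : ∀ {z} → z ≡ a → ⌊ a + a /2⌋ ≡ z
  ⌊a+a/2⌋≡ z≡a = trans (sym (n≡⌊n+n/2⌋ a)) (sym z≡a)
  by-cases : line a x ≡ pair x ⊎ (x ≡ a × line a x ≡ single (a + a)) →
             line a y ≡ pair y ⊎ (y ≡ a × line a y ≡ single (a + a)) →
             A r c ≡ just (odd (suc L + splitLevel x y))
  by-cases (inj₁ ex)          (inj₁ ey)          = contracted r c ex ey sep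
  by-cases (inj₁ ex)          (inj₂ (y≡a , ey)) =
    trans (contracted r c ex ey (λ e → sep (trans e (⌊a+a/2⌋≡ y≡a))))
          (cong (λ z → just (odd (suc L + splitLevel x z))) (⌊a+a/2⌋≡ y≡a))
  by-cases (inj₂ (x≡a , ex)) (inj₁ ey)          =
    trans (contracted r c ex ey (λ e → sep (trans (sym (⌊a+a/2⌋≡ x≡a)) e)))
          (cong (λ z → just (odd (suc L + splitLevel z y))) (⌊a+a/2⌋≡ x≡a))
  by-cases (inj₂ (x≡a , _))  (inj₂ (y≡a , _))  = ⊥-elim (sep (trans x≡a (sym y≡a)))

mergePair-contracted : ∀ {R L a} (A : SMat (suc (suc R)) (suc (suc R))) (i : Fin (suc R)) → toℕ i ≡ a →
                       Contracted L a a A → Contracted L (suc a) (suc a) (mergeCols (mergeRows A i) i)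
mergePair-contracted A i i≡a contracted =
  colMerge-contracted (mergeRows A i) i i≡a (rowMerge-contracted A i i≡a contracted)

mergePair : ∀ {R L a} (A : SMat (suc (suc R)) (suc (suc R))) (i : Fin (suc R)) → toℕ i ≡ a → Contracted L a a A →
            MergeSeq 3 (suc R) (suc R) (mergeCols (mergeRows A i) i) → MergeSeq 3 (suc (suc R)) (suc (suc R)) A
mergePair A i i≡a contracted rest =
  rowMerge A i (contracted-bounded contracted)
    (colMerge (mergeRows A i) i (contracted-bounded (rowMerge-contracted A i i≡a contracted)) rest)

mergeSequence : ∀ R {L a} (A : SMat (suc R) (suc R)) → Contracted L a a A → MergeSeq 3 (suc R) (suc R) A
mergeSequence zero    A contracted = done A (contracted-bounded contracted)
mergeSequence (suc R) {L} {a} A contracted with a ≤? R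
... | yes a≤R = mergePair A i i≡a contracted (mergeSequence R _ (mergePair-contracted A i i≡a contracted))
  where
  i = fromℕ< (s≤s a≤R)
  i≡a = toℕ-fromℕ< (s≤s a≤R)
... | no  a≰R = mergePair A zero refl promoted (mergeSequence R _ (mergePair-contracted A zero refl promoted))
  where
  promoted = promote A (≰⇒> a≰R) contracted

matrix-contracted : ∀ n → Contracted 0 0 0 (toSym (matrix n))
matrix-contracted n r c el el' sep with trans (sym el) (line-≥ {0} z≤n) | trans (sym el') (line-≥ {0} z≤n)
... | refl | refl = cong just (entry-offdiag sep)

twinWidth≤3 : ∀ m → TwinWidthAtMost 3 (matrix (suc m))
twinWidth≤3 m = id , id , mergeSequence m {0} {0} (toSym (matrix (suc m))) (matrix-contracted (suc m))

theorem4 : Σ ℕ λ p → Σ ℕ λ q → (0 < p) × (0 < q) ×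
    (∀ n → n ≥ 2 → Σ (BinMat n n) λ M →
      TwinWidthAtMost 3 M ×
      RowCoherenceAtLeast (p * (n * ⌊log₂ n ⌋)) q M ×
      ColCoherenceAtLeast (p * (n * ⌊log₂ n ⌋)) q M)
theorem4 = 1 , 16 , z<s , z<s , witness
  where
  witness : ∀ n → n ≥ 2 → Σ (BinMat n n) λ M →
            TwinWidthAtMost 3 M ×
            RowCoherenceAtLeast (1 * (n * ⌊log₂ n ⌋)) 16 M ×
            ColCoherenceAtLeast (1 * (n * ⌊log₂ n ⌋)) 16 M
  witness (suc m) _ =
    matrix (suc m) , twinWidth≤3 m ,
    (λ π → ≤-trans (≤-reflexive (*-identityˡ _)) (rowHammingSum-lower-bound π _ (λ _ _ → refl))) ,
    (λ π → ≤-trans (≤-reflexive (*-identityˡ _)) (rowHammingSum-lower-bound π _ (λ i j → entry-sym (toℕ j) (toℕ i))))
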